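{- Let $C_{8}(1,3)$ be the graph with vertex set $\{v_0,\dots,v_{7}\}$ and edge set $\{v_iv_{i+1}\}_{0\le i\le 7}\cup\{v_iv_{i+3}\}_{0\le i\le 7}$, indices modulo $8$. Then $\chi''(C_{8}(1,3)) = 6$.
   Context: A total $k$-colouring of a simple graph $G$ is a map $\sigma: V(G)\cup E(G)\to\{1,\dots,k\}$ such that adjacent vertices receive distinct colours, adjacent edges receive distinct colours, and each vertex receives a colour different from those of its incident edges. $\chi''(G)$ is the least such $k$. -}

module Defs where

open import Data.Nat using (ℕ; _+_; _%_; _≤_)
open import Data.Fin using (Fin; toℕ)
open import Data.Sum using (_⊎_)
open import Data.Product using (_×_)
open import Relation.Binary.PropositionalEquality using (_≡_; _≢_)

-- A (simple) graph is given by vertex set Fin n and a symmetric adjacency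
-- relation Adj (loop-free for the graph used below).

-- The edge uv is
-- coloured by ec u v p (p a proof of adjacency); the colour may not depend
-- on the orientation or on the adjacency proof.
record TotalColouring (n : ℕ) (Adj : Fin n → Fin n → Set) (k : ℕ) : Set where
  field
    vc : Fin n → Fin k
    ec : (u v : Fin n) → Adj u v → Fin k
    ec-wd    : ∀ u v (p : Adj u v) (q : Adj v u) → ec u v p ≡ ec v u q
    vertices : ∀ u v (p : Adj u v) → vc u ≢ vc v
    edges    : ∀ u v w (p : Adj u v) (q : Adj u w) → v ≢ w → ec u v p ≢ ec u w q
    incident : ∀ u v (p : Adj u v) → vc u ≢ ec u v p

TotalChromaticNumber : (n : ℕ) → (Fin n → Fin n → Set) → ℕ → Set
TotalChromaticNumber n Adj k =
  TotalColouring n Adj k × (∀ m → TotalColouring n Adj m → k ≤ m)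

Step : Fin 8 → Fin 8 → Set
Step i j = (toℕ j ≡ (toℕ i + 1) % 8) ⊎ (toℕ j ≡ (toℕ i + 3) % 8)

C8-1-3 : Fin 8 → Fin 8 → Set
C8-1-3 i j = Step i j ⊎ Step j i

{-# OPTIONS --safe #-}
-- C₈(1,3) is the complete bipartite graph K₄,₄ on the even and the odd
-- vertices, since 1 and 3 are odd.  Every vertex and its d incident edges
-- need d + 1 distinct colours.  In a total (d+1)-colouring of K_d,d each such
-- star therefore uses every colour, so the colour c of a fixed left vertex v
-- occurs at every right vertex r, necessarily on an edge r x with x ≠ v; the
-- d choices of r give d distinct such x among the d - 1 left vertices other
-- than v.  Hence χ''(K_d,d) ≥ d + 2, and six colours suffice for K₄,₄: the
-- edge between left vertex i and right vertex j gets colour i + j mod 4, and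
-- the two sides get the two remaining colours.
module Submission where

open import Defs
open import Data.Nat as ℕ using (ℕ; suc; _+_; _≤_)
open import Data.Nat.DivMod using (_mod_)
open import Data.Nat.Properties using (+-comm; 1+n≰n; ≤∧≢⇒<)
open import Data.Fin using (Fin; zero; suc; toℕ; punchOut; combine; quotient; remainder; _↑ˡ_; _↑ʳ_; _≟_)
open import Data.Fin.Properties using (all?; any?; injective⇒≤; punchOut-injective; combine-injectiveˡ)
open import Data.Product using (∃; _,_; proj₁)
open import Data.Sum using (swap)
open import Function using (_∘_)
open import Function.Definitions using (Injective; StrictlySurjective)
open import Relation.Binary.Definitions using (Symmetric)
open import Relation.Binary.PropositionalEquality using (_≡_; _≢_; refl; sym; trans; cong)
open import Relation.Nullary using (¬_; Dec; yes; no; contradiction)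
open import Relation.Nullary.Decidable using (True; toWitness; ¬?; _→-dec_; _⊎-dec_; decidable-stable)

injective⇒strictlySurjective : ∀ {n} {f : Fin n → Fin n} →
                               Injective _≡_ _≡_ f → StrictlySurjective _≡_ f
injective⇒strictlySurjective {suc n} {f} f-inj c with any? (λ i → f i ≟ c)
... | yes hit = hit
... | no miss = contradiction (injective⇒≤ punchOut∘f-injective) 1+n≰n
  where
  c≢f : ∀ i → c ≢ f i
  c≢f i c≡fi = miss (i , sym c≡fi)

  punchOut∘f-injective : Injective _≡_ _≡_ (λ i → punchOut (c≢f i))
  punchOut∘f-injective = f-inj ∘ punchOut-injective (c≢f _) (c≢f _)

module Star {n k} {Adj : Fin n → Fin n → Set} (T : TotalColouring n Adj k) where
  open TotalColouring T

  ec-injectiveʳ : ∀ u v w (p : Adj u v) (q : Adj u w) → ec u v p ≡ ec u w q → v ≡ w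
  ec-injectiveʳ u v w p q e = decidable-stable (v ≟ w) (λ v≢w → edges u v w p q v≢w e)

  starColours : ∀ {d} u (nb : Fin d → Fin n) → (∀ b → Adj u (nb b)) → Fin (suc d) → Fin k
  starColours u nb u~nb zero    = vc u
  starColours u nb u~nb (suc b) = ec u (nb b) (u~nb b)

  starColours-injective : ∀ {d} u {nb : Fin d → Fin n} (u~nb : ∀ b → Adj u (nb b)) →
                          Injective _≡_ _≡_ nb → Injective _≡_ _≡_ (starColours u nb u~nb)
  starColours-injective u u~nb nb-inj {zero}  {zero}   e = refl
  starColours-injective u u~nb nb-inj {zero}  {suc b}  e = contradiction e (incident u _ (u~nb b))
  starColours-injective u u~nb nb-inj {suc b} {zero}   e = contradiction (sym e) (incident u _ (u~nb b))
  starColours-injective u u~nb nb-inj {suc b} {suc b′} e =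
    cong suc (nb-inj (ec-injectiveʳ u _ _ (u~nb b) (u~nb b′) e))

  degree<colours : ∀ {d} u {nb : Fin d → Fin n} → (∀ b → Adj u (nb b)) →
                   Injective _≡_ _≡_ nb → suc d ≤ k
  degree<colours u u~nb nb-inj = injective⇒≤ (starColours-injective u u~nb nb-inj)

record CompleteBipartiteSubgraph {n} (d : ℕ) (Adj : Fin n → Fin n → Set) : Set where
  field
    left right      : Fin d → Fin n
    left-injective  : Injective _≡_ _≡_ left
    right-injective : Injective _≡_ _≡_ right
    adjacent        : ∀ a b → Adj (left a) (right b)

module _ {n d} {Adj : Fin n → Fin n → Set} (Adj-sym : Symmetric Adj)
         (K : CompleteBipartiteSubgraph (suc d) Adj) where
  open CompleteBipartiteSubgraph K

  noTotalColouring : ¬ TotalColouring n Adj (suc (suc d))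
  noTotalColouring T = contradiction (injective⇒≤ witness-injective) 1+n≰n
    where
    open TotalColouring T
    open Star T

    κ : Fin (suc d) → Fin (suc d) → Fin (suc (suc d))
    κ a b = ec (left a) (right b) (adjacent a b)

    right~left : ∀ b a → Adj (right b) (left a)
    right~left b a = Adj-sym (adjacent a b)

    c-on-far-edge : ∀ b → ∃ λ (j : Fin d) → κ (suc j) b ≡ vc (left zero)
    c-on-far-edge b with injective⇒strictlySurjective
                           (starColours-injective (right b) (right~left b) left-injective) (vc (left zero))
    ... | zero , c≡ = contradiction (sym c≡) (vertices _ _ (adjacent zero b))
    ... | suc zero , c≡ =
      contradiction (sym (trans (ec-wd _ _ (adjacent zero b) (right~left b zero)) c≡))
                    (incident _ _ (adjacent zero b))
    ... | suc (suc j) , c≡ = j , trans (ec-wd _ _ (adjacent (suc j) b) (right~left b (suc j))) c≡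

    witness-injective : Injective _≡_ _≡_ (proj₁ ∘ c-on-far-edge)
    witness-injective {b} {b′} j≡j′ with c-on-far-edge b | c-on-far-edge b′ | j≡j′
    ... | j , c≡ | .j , c≡′ | refl =
      right-injective (ec-injectiveʳ _ _ _ (adjacent (suc j) b) (adjacent (suc j) b′) (trans c≡ (sym c≡′)))

  totalColours≥ : ∀ {m} → TotalColouring n Adj m → 3 + d ≤ m
  totalColours≥ T = ≤∧≢⇒< (Star.degree<colours T (left zero) (adjacent zero) right-injective)
                          (λ { refl → noTotalColouring T })

module _ {n k} {Adj : Fin n → Fin n → Set} (Adj? : ∀ u v → Dec (Adj u v))
         (vc : Fin n → Fin k) (ec : Fin n → Fin n → Fin k) where

  properVertices? : Dec (∀ u v → Adj u v → vc u ≢ vc v)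
  properVertices? = all? λ u → all? λ v → Adj? u v →-dec ¬? (vc u ≟ vc v)

  properEdges? : Dec (∀ u v w → Adj u v → Adj u w → v ≢ w → ec u v ≢ ec u w)
  properEdges? = all? λ u → all? λ v → all? λ w →
    Adj? u v →-dec (Adj? u w →-dec (¬? (v ≟ w) →-dec ¬? (ec u v ≟ ec u w)))

  properIncidence? : Dec (∀ u v → Adj u v → vc u ≢ ec u v)
  properIncidence? = all? λ u → all? λ v → Adj? u v →-dec ¬? (vc u ≟ ec u v)

  checkedTotalColouring : (∀ u v → ec u v ≡ ec v u) →
                          True properVertices? → True properEdges? → True properIncidence? →
                          TotalColouring n Adj k
  checkedTotalColouring ec-sym vs es is = record
    { vc       = vc
    ; ec       = λ u v _ → ec u v
    ; ec-wd    = λ u v _ _ → ec-sym u v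
    ; vertices = toWitness vs
    ; edges    = toWitness es
    ; incident = toWitness is
    }

C8-1-3? : ∀ u v → Dec (C8-1-3 u v)
C8-1-3? u v = ((toℕ v ℕ.≟ (toℕ u + 1) ℕ.% 8) ⊎-dec (toℕ v ℕ.≟ (toℕ u + 3) ℕ.% 8))
       ⊎-dec ((toℕ u ℕ.≟ (toℕ v + 1) ℕ.% 8) ⊎-dec (toℕ u ℕ.≟ (toℕ v + 3) ℕ.% 8))

C8-1-3-sym : Symmetric C8-1-3
C8-1-3-sym = swap

even odd : Fin 4 → Fin 8
even i = combine {4} {2} i zero
odd  i = combine {4} {2} i (suc zero)

K₄,₄ : CompleteBipartiteSubgraph 4 C8-1-3
K₄,₄ = record
  { left            = even
  ; right           = odd
  ; left-injective  = λ {i} {j} → combine-injectiveˡ i zero j zero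
  ; right-injective = λ {i} {j} → combine-injectiveˡ i (suc zero) j (suc zero)
  ; adjacent        = toWitness {a? = all? λ a → all? λ b → C8-1-3? (even a) (odd b)} _
  }

-- Vertex u is the pair (quotient u, remainder u) = (⌊u/2⌋, parity of u).
vertexColour : Fin 8 → Fin 6
vertexColour u = 4 ↑ʳ remainder {4} 2 u

edgeColour : Fin 8 → Fin 8 → Fin 6
edgeColour u v = ((toℕ (quotient {4} 2 u) + toℕ (quotient {4} 2 v)) mod 4) ↑ˡ 2

edgeColour-sym : ∀ u v → edgeColour u v ≡ edgeColour v u
edgeColour-sym u v = cong (λ s → (s mod 4) ↑ˡ 2) (+-comm (toℕ (quotient {4} 2 u)) _)

lemma9 : TotalChromaticNumber 8 C8-1-3 6
lemma9 = checkedTotalColouring C8-1-3? vertexColour edgeColour edgeColour-sym _ _ _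
       , λ _ → totalColours≥ C8-1-3-sym K₄,₄
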